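{- Let $\mathcal{R}$ be a commutative ring with unity and let $\mathcal{I}\subsetneq\mathcal{R}$ be an ideal satisfying the unital set condition (USC). Let $\mathcal{J}$ be an ideal with $\mathcal{I}\subseteq\mathcal{J}\subsetneq\mathcal{R}$. Then $\mathcal{J}$ also satisfies the USC.
   Context: A finite subset of $\mathcal{R}$ is unital if it generates the unit ideal. An ideal $\mathcal{K}\subsetneq\mathcal{R}$ satisfies the USC if for every $n\ge2$ and every unital set $\{a_1,\ldots,a_n\}\subseteq\mathcal{R}$ there exists $b\in\langle a_2,\ldots,a_n\rangle$ such that $a_1+b$ is a unit modulo $\mathcal{K}$. -}

module Defs where

open import Level using (Level; _⊔_)
open import Algebra.Bundles using (CommutativeRing)
open import Data.Nat using (ℕ; _≥_)
import Data.Nat as ℕ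
open import Data.Fin using (Fin; zero; suc)
open import Data.Product using (Σ; ∃; _×_; _,_)
open import Relation.Nullary using (¬_)

module _ {c ℓ : Level} (R : CommutativeRing c ℓ) where
  open CommutativeRing R hiding (zero)

  sumFin : (n : ℕ) → (Fin n → Carrier) → Carrier
  sumFin ℕ.zero    f = 0#
  sumFin (ℕ.suc n) f = f zero + sumFin n (λ i → f (suc i))

  record IsIdeal {p : Level} (I : Carrier → Set p) : Set (c ⊔ ℓ ⊔ p) where
    field
      respects : ∀ {x y} → x ≈ y → I x → I y
      zero∈    : I 0#
      +-closed : ∀ {x y} → I x → I y → I (x + y)
      *-closed : ∀ r {x} → I x → I (r * x)

  IsProperIdeal : {p : Level} → (Carrier → Set p) → Set (c ⊔ ℓ ⊔ p)
  IsProperIdeal I = IsIdeal I × ¬ I 1#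

  InSpan : (n : ℕ) → (Fin n → Carrier) → Carrier → Set (c ⊔ ℓ)
  InSpan n a x = Σ (Fin n → Carrier) λ r → x ≈ sumFin n (λ i → r i * a i)

  Unital : (n : ℕ) → (Fin n → Carrier) → Set (c ⊔ ℓ)
  Unital n a = InSpan n a 1#

  UnitMod : {p : Level} → (Carrier → Set p) → Carrier → Set (c ⊔ p)
  UnitMod K x = ∃ λ y → K (x * y - 1#)

  -- the unital set condition for K.  A set {a_1,…,a_n} (n ≥ 2) is an indexed
  -- family a : Fin (suc m) → R with m ≥ 1; a zero plays a_1, a ∘ suc plays a_2..a_n.
  USC : {p : Level} → (Carrier → Set p) → Set (c ⊔ ℓ ⊔ p)
  USC K = (m : ℕ) → m ≥ 1 → (a : Fin (ℕ.suc m) → Carrier) → Unital (ℕ.suc m) a →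
          Σ Carrier λ b → InSpan m (λ i → a (suc i)) b × UnitMod K (a zero + b)

{-# OPTIONS --safe #-}
module Submission where

open import Defs
open import Level using (Level)
open import Algebra.Bundles using (CommutativeRing)
open import Data.Product using (_,_)

module _ {c ℓ : Level} (R : CommutativeRing c ℓ) where
  open CommutativeRing R using (Carrier)

  UnitMod-mono : {p q : Level} (K : Carrier → Set p) (L : Carrier → Set q) →
                 (∀ {x} → K x → L x) → ∀ {x} → UnitMod R K x → UnitMod R L x
  UnitMod-mono K L K⊆L (y , xy-1∈K) = y , K⊆L xy-1∈K

  USC-mono : {p q : Level} (K : Carrier → Set p) (L : Carrier → Set q) →
             (∀ {x} → K x → L x) → USC R K → USC R L
  USC-mono K L K⊆L uscK m m≥1 a unital with uscK m m≥1 a unital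
  ... | b , b∈span , unit = b , b∈span , UnitMod-mono K L K⊆L unit

-- Neither ideal needs to be proper: the USC is upward closed under inclusion of predicates.
mainTheorem17 : {c ℓ p q : Level} (R : CommutativeRing c ℓ) →
    (I : CommutativeRing.Carrier R → Set p) → (J : CommutativeRing.Carrier R → Set q) →
    IsProperIdeal R I → USC R I →
    IsProperIdeal R J → (∀ {x} → I x → J x) →
    USC R J
mainTheorem17 R I J _ uscI _ I⊆J = USC-mono R I J I⊆J uscI
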